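{- Let $\alpha(x)\in\mathcal{FOL}$ be a formula with one free variable $x$ that is preserved by meet-simulations. Let $\mathcal{M}$ be a structure in $\mathsf{FSL}$ with domain $W$, and let $(W,1,\curlywedge)$ be the meet-semilattice induced by the interpretation of $R$. Then the set $\{w\in W\mid\mathcal{M}\models\alpha(x)[w]\}$ is either empty or a filter of $(W,1,\curlywedge)$.
   Context: $\mathrm{Prop}$ is a fixed set of proposition letters. $\mathcal{FOL}$ is the first-order language (with equality) with a binary predicate $R$ and unary predicates $P_p$ ($p\in\mathrm{Prop}$). Let $\mathsf{ismeet}(x,y,z):=xRy\wedge xRz\wedge\forall x'((x'Ry\wedge x'Rz)\to x'Rx)$. $\mathsf{FSL}$ is the class of $\mathcal{FOL}$-structures in which $R$ is a partial order, any two elements have an $R$-greatest lower bound, there is an $R$-greatest element, and each unary predicate $P$ satisfies $(\exists wPw)\wedge\forall x\forall y\forall z(\mathsf{ismeet}(x,y,z)\to((Py\wedge Pz)\leftrightarrow Px))$. Such a structure induces a meet-semilattice $(W,1,\curlywedge)$ (with $\preccurlyeq$ the interpretation of $R$, $1$ the top, $\curlywedge$ binary meet) and an L$_1$-model $(W,1,\curlywedge,V)$ with $V(p)$ the interpretation of $P_p$; conversely an L$_1$-model $\mathfrak{M}$ (meet-semilattice where every finite subset has a meet, with each $V(p)$ a filter, i.e. a $\preccurlyeq$-upward closed subset closed under finite meets) gives the structure $\mathfrak{M}^{\circ}$. A meet-simulation from an L$_1$-model $\mathfrak{M}=(W,1,\curlywedge,V)$ to $\mathfrak{M}'=(W',1',\curlywedge',V')$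 is $T\subseteq W\times W\times W'$ such that for all $(w_1,w_2,w')\in T$: (M1) if $w_1,w_2\in V(p)$ then $w'\in V'(p)$; (M2) if $w_1=w_2=1$ then $w'=1'$; (M3) if $u_1\curlywedge v_1\preccurlyeq w_1$ and $u_2\curlywedge v_2\preccurlyeq w_2$, then there exist $v',u'\in W'$ with $(u_1,u_2,u'),(v_1,v_2,v')\in T$ and $v'\curlywedge'u'\preccurlyeq'w'$. $\alpha(x)$ is preserved by meet-simulations if whenever $T$ is a meet-simulation from $\mathfrak{M}$ to $\mathfrak{M}'$ with $(w_1,w_2,w')\in T$ and $\mathfrak{M}^{\circ}\models\alpha(x)[w_1]$, $\mathfrak{M}^{\circ}\models\alpha(x)[w_2]$, then $\mathfrak{M}'^{\circ}\models\alpha(x)[w']$. -}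

module Defs where

open import Data.Nat using (ℕ; suc)
open import Data.Fin using (Fin; zero; suc)
open import Data.Product using (Σ; _×_; _,_; proj₁)
open import Data.Empty using (⊥)
open import Relation.Nullary using (¬_)
open import Relation.Binary.PropositionalEquality using (_≡_)

module _ (Prop : Set) where

  data Formula (n : ℕ) : Set where
    Rf   : Fin n → Fin n → Formula n
    Pf   : Prop → Fin n → Formula n
    Eqf  : Fin n → Fin n → Formula n
    ⊥f   : Formula n
    ¬f   : Formula n → Formula n
    _∧f_ : Formula n → Formula n → Formula n
    _∨f_ : Formula n → Formula n → Formula n
    _⇒f_ : Formula n → Formula n → Formula n
    ∀f   : Formula (suc n) → Formula n
    ∃f   : Formula (suc n) → Formula n

  record Structure : Set₁ where
    field
      W : Set
      R : W → W → Set
      P : Prop → W → Set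

  _∷ₑ_ : {W : Set} {n : ℕ} → W → (Fin n → W) → Fin (suc n) → W
  (w ∷ₑ ρ) zero    = w
  (w ∷ₑ ρ) (suc i) = ρ i

  -- Classical (Tarskian) satisfaction, rendered constructively via the
  -- Goedel-Gentzen negative translation (all clauses are ¬¬-stable and,
  -- under excluded middle, coincide with the usual Tarski clauses).
  Sat : (M : Structure) {n : ℕ} → Formula n → (Fin n → Structure.W M) → Set
  Sat M (Rf i j)  ρ = ¬ ¬ Structure.R M (ρ i) (ρ j)
  Sat M (Pf p i)  ρ = ¬ ¬ Structure.P M p (ρ i)
  Sat M (Eqf i j) ρ = ¬ ¬ (ρ i ≡ ρ j)
  Sat M ⊥f        ρ = ⊥
  Sat M (¬f φ)    ρ = ¬ Sat M φ ρ
  Sat M (φ ∧f ψ)  ρ = Sat M φ ρ × Sat M ψ ρ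
  Sat M (φ ∨f ψ)  ρ = ¬ (¬ Sat M φ ρ × ¬ Sat M ψ ρ)
  Sat M (φ ⇒f ψ)  ρ = Sat M φ ρ → Sat M ψ ρ
  Sat M (∀f φ)    ρ = (w : Structure.W M) → Sat M φ (w ∷ₑ ρ)
  Sat M (∃f φ)    ρ = ¬ ((w : Structure.W M) → ¬ Sat M φ (w ∷ₑ ρ))

  _⊨_[_] : (M : Structure) → Formula 1 → Structure.W M → Set
  M ⊨ α [ w ] = Sat M α (λ _ → w)

  module _ (M : Structure) where
    open Structure M

    ismeet : W → W → W → Set
    ismeet x y z = R x y × R x z × ((x' : W) → R x' y → R x' z → R x' x)

  record IsFSL (M : Structure) : Set where
    open Structure M
    field
      R-refl    : (x : W) → R x x
      R-trans   : (x y z : W) → R x y → R y z → R x z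
      R-antisym : (x y : W) → R x y → R y x → x ≡ y
      glb       : (y z : W) → Σ W (λ x → ismeet M x y z)
      top       : Σ W (λ t → (w : W) → R w t)
      P-nonempty : (p : Prop) → Σ W (P p)
      P-meet    : (p : Prop) (x y z : W) → ismeet M x y z →
                  ((P p y × P p z) → P p x) × (P p x → (P p y × P p z))

  record FSLStructure : Set₁ where
    field
      str : Structure
      fsl : IsFSL str
    open Structure str public
    open IsFSL fsl public

    𝟙 : W
    𝟙 = proj₁ top

    _⋏_ : W → W → W
    x ⋏ y = proj₁ (glb x y)

  open FSLStructure

  IsMeetSimulation : (M M' : FSLStructure) →
                     (W M → W M → W M' → Set) → Set
  IsMeetSimulation M M' T =
    (w₁ w₂ : W M) (w' : W M') → T w₁ w₂ w' →
      ((p : Prop) → P M p w₁ → P M p w₂ → P M' p w')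
    × (w₁ ≡ 𝟙 M → w₂ ≡ 𝟙 M → w' ≡ 𝟙 M')
    × ((u₁ v₁ u₂ v₂ : W M) →
         R M (_⋏_ M u₁ v₁) w₁ → R M (_⋏_ M u₂ v₂) w₂ →
         Σ (W M') (λ v' → Σ (W M') (λ u' →
           T u₁ u₂ u' × T v₁ v₂ v' × R M' (_⋏_ M' v' u') w')))

  PreservedByMeetSimulations : Formula 1 → Set₁
  PreservedByMeetSimulations α =
    (M M' : FSLStructure) (T : W M → W M → W M' → Set) →
    IsMeetSimulation M M' T →
    (w₁ w₂ : W M) (w' : W M') → T w₁ w₂ w' →
    str M ⊨ α [ w₁ ] → str M ⊨ α [ w₂ ] → str M' ⊨ α [ w' ]

  IsFilter : (M : FSLStructure) → (W M → Set) → Set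
  IsFilter M S =
      S (𝟙 M)
    × ((u v : W M) → R M u v → S u → S v)
    × ((u v : W M) → S u → S v → S (_⋏_ M u v))

  IsEmpty : (M : FSLStructure) → (W M → Set) → Set
  IsEmpty M S = (w : W M) → ¬ S w

-- The relation T(w₁, w₂, w') :⇔ w₁ ⋏ w₂ ≼ w' is a meet-simulation from the
-- induced L₁-model to itself. If α holds at some point w, then preservation
-- along T(w, w, 1), T(u, u, v) for u ≼ v, and T(u, v, u ⋏ v) shows that the
-- extension of α contains 1, is upward closed and is closed under meets.
module Submission where

open import Defs
open import Data.Sum using (_⊎_; inj₁; inj₂)
open import Relation.Nullary using (¬_)
open import Data.Product using (Σ; _×_; _,_; proj₁; proj₂)
open import Relation.Binary.PropositionalEquality using (_≡_; refl)

module FSLProperties {Prop : Set} (M : FSLStructure Prop) where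
  open FSLStructure M

  ≼-trans : ∀ {x y z} → R x y → R y z → R x z
  ≼-trans = R-trans _ _ _

  x⋏y≼x : ∀ x y → R (x ⋏ y) x
  x⋏y≼x x y = proj₁ (proj₂ (glb x y))

  x⋏y≼y : ∀ x y → R (x ⋏ y) y
  x⋏y≼y x y = proj₁ (proj₂ (proj₂ (glb x y)))

  ⋏-greatest : ∀ {x y z} → R z x → R z y → R z (x ⋏ y)
  ⋏-greatest {x} {y} {z} = proj₂ (proj₂ (proj₂ (glb x y))) z

  ⋏-mono : ∀ {x y u v} → R x u → R y v → R (x ⋏ y) (u ⋏ v)
  ⋏-mono {x} {y} x≼u y≼v =
    ⋏-greatest (≼-trans (x⋏y≼x x y) x≼u) (≼-trans (x⋏y≼y x y) y≼v)

  ⋏-interchange : ∀ u₁ v₁ u₂ v₂ →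
                  R ((v₁ ⋏ v₂) ⋏ (u₁ ⋏ u₂)) ((u₁ ⋏ v₁) ⋏ (u₂ ⋏ v₂))
  ⋏-interchange u₁ v₁ u₂ v₂ =
    ⋏-greatest (⋏-greatest (≼-trans (x⋏y≼y _ _) (x⋏y≼x u₁ u₂))
                           (≼-trans (x⋏y≼x _ _) (x⋏y≼x v₁ v₂)))
               (⋏-greatest (≼-trans (x⋏y≼y _ _) (x⋏y≼y u₁ u₂))
                           (≼-trans (x⋏y≼x _ _) (x⋏y≼y v₁ v₂)))

  𝟙≼⇒≡𝟙 : ∀ {w} → R 𝟙 w → w ≡ 𝟙
  𝟙≼⇒≡𝟙 {w} 𝟙≼w = R-antisym w 𝟙 (proj₂ top w) 𝟙≼w

  P-upward-closed : ∀ p {x y} → R x y → P p x → P p y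
  P-upward-closed p {x} {y} x≼y Px =
    proj₂ (proj₂ (P-meet p x x y (R-refl x , x≼y , λ _ x'≼x _ → x'≼x)) Px)

  P-⋏-closed : ∀ p {x y} → P p x → P p y → P p (x ⋏ y)
  P-⋏-closed p {x} {y} Px Py = proj₁ (P-meet p (x ⋏ y) x y (proj₂ (glb x y))) (Px , Py)

  MeetBelow : W → W → W → Set
  MeetBelow w₁ w₂ w' = R (w₁ ⋏ w₂) w'

  meetBelow-isMeetSimulation : IsMeetSimulation Prop M M MeetBelow
  meetBelow-isMeetSimulation w₁ w₂ w' w₁⋏w₂≼w' =
    preserves-P , preserves-𝟙 , forth
    where
    preserves-P : (p : Prop) → P p w₁ → P p w₂ → P p w'
    preserves-P p Pw₁ Pw₂ = P-upward-closed p w₁⋏w₂≼w' (P-⋏-closed p Pw₁ Pw₂)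

    preserves-𝟙 : w₁ ≡ 𝟙 → w₂ ≡ 𝟙 → w' ≡ 𝟙
    preserves-𝟙 refl refl = 𝟙≼⇒≡𝟙 (≼-trans (⋏-greatest (R-refl 𝟙) (R-refl 𝟙)) w₁⋏w₂≼w')

    forth : (u₁ v₁ u₂ v₂ : W) → R (u₁ ⋏ v₁) w₁ → R (u₂ ⋏ v₂) w₂ →
            Σ W (λ v' → Σ W (λ u' →
              MeetBelow u₁ u₂ u' × MeetBelow v₁ v₂ v' × R (v' ⋏ u') w'))
    forth u₁ v₁ u₂ v₂ ≼w₁ ≼w₂ =
      v₁ ⋏ v₂ , u₁ ⋏ u₂ , R-refl _ , R-refl _ ,
      ≼-trans (⋏-interchange u₁ v₁ u₂ v₂) (≼-trans (⋏-mono ≼w₁ ≼w₂) w₁⋏w₂≼w')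

module _ {Prop : Set} {α : Formula Prop 1} (preserved : PreservedByMeetSimulations Prop α)
         (M : FSLStructure Prop) where
  open FSLStructure M
  open FSLProperties M

  Extension : W → Set
  Extension w = _⊨_[_] Prop str α w

  Extension-transfer : ∀ {w₁ w₂ w'} → R (w₁ ⋏ w₂) w' →
                       Extension w₁ → Extension w₂ → Extension w'
  Extension-transfer = preserved M M MeetBelow meetBelow-isMeetSimulation _ _ _

  inhabited-Extension-isFilter : ∀ w → Extension w → IsFilter Prop M Extension
  inhabited-Extension-isFilter w αw =
      Extension-transfer (proj₂ top (w ⋏ w)) αw αw
    , (λ u v u≼v αu → Extension-transfer (≼-trans (x⋏y≼x u u) u≼v) αu αu)
    , (λ u v αu αv → Extension-transfer (R-refl (u ⋏ v)) αu αv)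

¬¬-empty-or : {A : Set} {S : A → Set} {Q : Set} →
              (∀ a → S a → Q) → ¬ ¬ ((∀ a → ¬ S a) ⊎ Q)
¬¬-empty-or inhabited⇒Q k = k (inj₁ λ a Sa → k (inj₂ (inhabited⇒Q a Sa)))

lemma7p10 : (Prop : Set) (α : Formula Prop 1) →
    PreservedByMeetSimulations Prop α →
    (M : FSLStructure Prop) →
    ¬ ¬ (IsEmpty Prop M (λ w → _⊨_[_] Prop (FSLStructure.str M) α w)
    ⊎ IsFilter Prop M (λ w → _⊨_[_] Prop (FSLStructure.str M) α w))
lemma7p10 Prop α preserved M = ¬¬-empty-or (inhabited-Extension-isFilter preserved M)
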